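{- Suppose $n \geq 2$, $t \in \mathbb{N}$, $G = K_{n,1}$ with partite sets $\{v_1,\dots,v_n\}$ and $\{u_1\}$, and $\mathcal{H} = (L,H)$ is an $((n+1)t-1)$-fold cover of $G$. For $i \in [n]$ let $\mathcal{A}_i$ be the set of all $t$-element subsets of $L(v_i)$. Then the number of elements of $\prod_{i=1}^n \mathcal{A}_i$ that are bad for $u_1$ is at most $$\binom{(n+1)t-1}{nt} \prod_{i=0}^{n-2} \binom{(n-i)t}{t}.$$
   Context: $[n]=\{1,\dots,n\}$. A cover of a graph $G$ is a pair $\mathcal{H}=(L,H)$ where $H$ is a graph and $L: V(G)\to\mathcal{P}(V(H))$ satisfies: (1) $\{L(u): u\in V(G)\}$ is a partition of $V(H)$; (2) for every $u\in V(G)$, $H[L(u)]$ is complete; (3) if there is an edge of $H$ between $L(u)$ and $L(v)$ then $u=v$ or $uv\in E(G)$; (4) if $uv\in E(G)$, the edges of $H$ between $L(u)$ and $L(v)$ form a matching (possibly empty). The cover is $a$-fold if $|L(u)|=a$ for all $u$. For $(A_1,\dots,A_n)\in\prod_{i=1}^n\mathcal{A}_i$ (Cartesian product), let $L^{(A_1,\dots,A_n)}(u_1)$ be the set of vertices of $L(u_1)$ that are not adjacent in $H$ to any vertex of $\bigcup_{i=1}^n A_i$. The tuple $(A_1,\dots,A_n)$ is called bad for $u_1$ if $|L^{(A_1,\dots,A_n)}(u_1)| < t$. -}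

module Defs where

open import Data.Nat using (ℕ; zero; suc; _≡ᵇ_; _<ᵇ_)
open import Data.Bool using (Bool; true; false; _∧_; _∨_; not)
open import Data.Fin using (Fin; zero; suc; fromℕ; inject₁)
open import Data.Fin.Subset using (Subset; _∈_; ∣_∣)
open import Data.Vec using (Vec; []; _∷_; lookup; tabulate)
open import Data.List using (List; []; _∷_; [_]; map; concatMap; filterᵇ; length)
open import Data.Product using (∃; _×_)
open import Data.Sum using (_⊎_)
open import Relation.Binary.PropositionalEquality using (_≡_; _≢_)

record Graph (k : ℕ) : Set where
  field
    adj    : Fin k → Fin k → Bool
    symm   : ∀ x y → adj x y ≡ adj y x
    irrefl : ∀ x → adj x x ≡ false
open Graph public

anyFin : {k : ℕ} → (Fin k → Bool) → Bool
anyFin {zero}  f = false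
anyFin {suc k} f = f zero ∨ anyFin (λ i → f (suc i))

allFin : {k : ℕ} → (Fin k → Bool) → Bool
allFin {zero}  f = true
allFin {suc k} f = f zero ∧ allFin (λ i → f (suc i))

-- K_{n,1}: vertex set Fin (suc n); v_i = inject₁ i (i : Fin n), u_1 = fromℕ n.
isLast : {n : ℕ} → Fin (suc n) → Bool
isLast {zero}  zero    = true
isLast {suc n} zero    = false
isLast {suc n} (suc i) = isLast i

xor : Bool → Bool → Bool
xor true  b = not b
xor false b = b

private
  xor-comm : ∀ a b → xor a b ≡ xor b a
  xor-comm true  true  = _≡_.refl
  xor-comm true  false = _≡_.refl
  xor-comm false true  = _≡_.refl
  xor-comm false false = _≡_.refl

  xor-self : ∀ a → xor a a ≡ false
  xor-self true  = _≡_.refl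
  xor-self false = _≡_.refl

Kn1 : (n : ℕ) → Graph (suc n)
Kn1 n = record
  { adj    = λ x y → xor (isLast x) (isLast y)
  ; symm   = λ x y → xor-comm (isLast x) (isLast y)
  ; irrefl = λ x → xor-self (isLast x) }

vtx : {n : ℕ} → Fin n → Fin (suc n)
vtx = inject₁

u₁ : {n : ℕ} → Fin (suc n)
u₁ {n} = fromℕ n

record IsCover {k m : ℕ} (G : Graph k) (H : Graph m) (L : Fin k → Subset m) : Set where
  field
    covers   : ∀ (x : Fin m) → ∃ λ u → x ∈ L u
    disjoint : ∀ (x : Fin m) (u w : Fin k) → x ∈ L u → x ∈ L w → u ≡ w
    complete : ∀ (u : Fin k) (x y : Fin m) → x ∈ L u → y ∈ L u → x ≢ y → adj H x y ≡ true
    respects : ∀ (u w : Fin k) (x y : Fin m) → x ∈ L u → y ∈ L w → adj H x y ≡ true →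
               u ≡ w ⊎ adj G u w ≡ true
    matching : ∀ (u w : Fin k) → adj G u w ≡ true → ∀ (x y z : Fin m) →
               x ∈ L u → y ∈ L w → z ∈ L w → adj H x y ≡ true → adj H x z ≡ true → y ≡ z

IsFold : {k m : ℕ} → ℕ → (Fin k → Subset m) → Set
IsFold a L = ∀ u → ∣ L u ∣ ≡ a

allSubsets : (m : ℕ) → List (Subset m)
allSubsets zero    = [ [] ]
allSubsets (suc m) = concatMap (λ s → (true ∷ s) ∷ (false ∷ s) ∷ []) (allSubsets m)

consF : {n m : ℕ} → Subset m → (Fin n → Subset m) → Fin (suc n) → Subset m
consF s f zero    = s
consF s f (suc i) = f i

allTuples : (n m : ℕ) → List (Fin n → Subset m)
allTuples zero    m = [ (λ ()) ]
allTuples (suc n) m = concatMap (λ s → map (consF s) (allTuples n m)) (allSubsets m)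

subsetᵇ : {m : ℕ} → Subset m → Subset m → Bool
subsetᵇ A B = allFin λ x → not (lookup A x) ∨ lookup B x

inProductᵇ : {n m : ℕ} → ℕ → (Fin (suc n) → Subset m) → (Fin n → Subset m) → Bool
inProductᵇ t L A = allFin λ i → subsetᵇ (A i) (L (vtx i)) ∧ (∣ A i ∣ ≡ᵇ t)

Lrestr : {n m : ℕ} → Graph m → (Fin (suc n) → Subset m) → (Fin n → Subset m) → Subset m
Lrestr H L A = tabulate λ x →
  lookup (L u₁) x ∧ not (anyFin λ i → anyFin λ y → lookup (A i) y ∧ adj H x y)

badᵇ : {n m : ℕ} → ℕ → Graph m → (Fin (suc n) → Subset m) → (Fin n → Subset m) → Bool
badᵇ t H L A = ∣ Lrestr H L A ∣ <ᵇ t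

numBad : (n m t : ℕ) → Graph m → (Fin (suc n) → Subset m) → ℕ
numBad n m t H L = length (filterᵇ (λ A → inProductᵇ t L A ∧ badᵇ t H L A) (allTuples n m))

-- Write S = L(u₁) and D_i = L(v_i).  The edges between S and each D_i form a matching,
-- so a t-subset of D_i deletes at most t vertices of S (its neighbours), and at least
-- |S| − n t vertices of S survive any tuple.  A bad tuple leaves fewer than t of the
-- (n+1)t − 1 vertices, hence deletes at least n t: it is "tight", each A_i deleting
-- exactly t new vertices.  Tight tuples are counted by peeling off A_1: it is
-- determined by the t vertices of S it deletes (its shadow), since every vertex of A_1
-- is the unique D_1-neighbour of a deleted vertex; the remaining sets form a tight tuple
-- for the |S| − t survivors.  So there are at most ∏_{i<n} C(|S| − i t, t) tight tuples,
-- and this product equals the bound of the theorem.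

module Submission where

open import Defs
open import Data.Nat using (ℕ; suc; _*_; _∸_; _≤_)
open import Data.Nat.Combinatorics using (_C_)
open import Data.List using (map; upTo)
open import Data.Nat.ListAction using (product)
open import Data.Fin using (Fin)
open import Data.Fin.Subset using (Subset)

open import Data.Bool using (Bool; true; false; _∧_; _∨_; not; T; T?)
open import Data.Bool.Properties using (T-∧; T-∨; T-≡; ∧-identityʳ)
open import Data.Empty using (⊥-elim)
open import Data.Fin using (zero; suc; inject₁; fromℕ)
open import Data.Fin.Subset using (∣_∣)
open import Data.List using (List; []; _∷_; _++_; length; filterᵇ; concatMap; applyUpTo)
import Data.List as List
open import Data.List.Membership.Propositional using (_∈_)
open import Data.List.Membership.Propositional.Properties using (∈-allFin; ∈-filter⁺; ∈-filter⁻)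
open import Data.List.Properties using (length-++; filter-++; filter-none; filter-some; length-filter)
open import Data.List.Relation.Unary.All using (All; []; _∷_)
import Data.List.Relation.Unary.All as All
open import Data.List.Relation.Unary.Any using (here; there)
import Data.List.Relation.Unary.Any as Any
open import Data.List.Relation.Unary.Unique.Propositional using (Unique)
open import Data.List.Relation.Unary.Unique.Propositional.Properties using (allFin⁺; filter⁺)
open import Data.List.Relation.Unary.AllPairs using ([]; _∷_)
open import Data.Nat using (zero; _+_; _<_; z≤n; s≤s; _≡ᵇ_; _≤ᵇ_; _!)
open import Data.Nat.Combinatorics using (nCk+nC[k+1]≡[n+1]C[k+1]; nCk≡n!/k![n-k]!; k![n∸k]!∣n!; nCn≡1)
open import Data.Nat.DivMod using (m/n*n≡m)
open import Data.Nat.Tactic.RingSolver using (solve-∀)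
open import Data.Nat.Properties
open import Data.Product using (Σ; ∃; _×_; _,_; proj₁; proj₂)
open import Data.Sum using (inj₁; inj₂)
open import Data.Vec using ([]; _∷_; lookup; tabulate; tail)
open import Data.Vec.Properties using (tabulate∘lookup; lookup∘tabulate; lookup⇒[]=)
open import Function using (_∘_; Equivalence)
open import Relation.Binary.PropositionalEquality
open import Relation.Nullary using (¬_)
open import Algebra.Properties.CommutativeSemigroup +-commutativeSemigroup using () renaming (x∙yz≈y∙xz to m+[n+o]≡n+[m+o])

open Equivalence using (to; from)

∧-split : ∀ a {b} → T (a ∧ b) → T a × T b
∧-split a = to (T-∧ {a})

∧-pair : ∀ {a b} → T a → T b → T (a ∧ b)
∧-pair p q = from T-∧ (p , q)

anyFin-witness : ∀ {k} (f : Fin k → Bool) → T (anyFin f) → ∃ λ i → T (f i)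
anyFin-witness {suc k} f p with to (T-∨ {f zero}) p
... | inj₁ q = zero , q
... | inj₂ q with anyFin-witness (f ∘ suc) q
...   | i , r = suc i , r

anyFin-intro : ∀ {k} (f : Fin k → Bool) (i : Fin k) → T (f i) → T (anyFin f)
anyFin-intro f zero    p = from T-∨ (inj₁ p)
anyFin-intro f (suc i) p = from (T-∨ {f zero}) (inj₂ (anyFin-intro (f ∘ suc) i p))

allFin-elim : ∀ {k} (f : Fin k → Bool) → T (allFin f) → ∀ i → T (f i)
allFin-elim f p zero    = proj₁ (∧-split (f zero) p)
allFin-elim f p (suc i) = allFin-elim (f ∘ suc) (proj₂ (∧-split (f zero) p)) i

allFin-intro : ∀ {k} (f : Fin k → Bool) → (∀ i → T (f i)) → T (allFin f)
allFin-intro {zero}  f h = _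
allFin-intro {suc k} f h = ∧-pair (h zero) (allFin-intro (f ∘ suc) (h ∘ suc))

subsetᵇ-elim : ∀ {m} (A B : Subset m) → T (subsetᵇ A B) → ∀ y → T (lookup A y) → T (lookup B y)
subsetᵇ-elim A B p y ay with lookup A y | allFin-elim _ p y
... | true | q = q

count : {A : Set} → (A → Bool) → List A → ℕ
count p xs = length (filterᵇ p xs)

count-mono : ∀ {A : Set} {p q : A → Bool} (xs : List A) →
             (∀ x → T (p x) → T (q x)) → count p xs ≤ count q xs
count-mono [] h = z≤n
count-mono {p = p} {q} (x ∷ xs) h with p x | q x | h x
... | true  | true  | _  = s≤s (count-mono xs h)
... | true  | false | hx = ⊥-elim (hx _)
... | false | true  | _  = m≤n⇒m≤1+n (count-mono xs h)
... | false | false | _  = count-mono xs h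

count-cong : ∀ {A : Set} {p q : A → Bool} (xs : List A) → (∀ x → p x ≡ q x) → count p xs ≡ count q xs
count-cong xs h = ≤-antisym (count-mono xs (λ x → subst T (h x))) (count-mono xs (λ x → subst T (sym (h x))))

count-split : ∀ {A : Set} (p g : A → Bool) (xs : List A) →
              count p xs ≡ count (λ x → p x ∧ g x) xs + count (λ x → p x ∧ not (g x)) xs
count-split p g [] = refl
count-split p g (x ∷ xs) with p x | g x
... | true  | true  = cong suc (count-split p g xs)
... | true  | false = trans (cong suc (count-split p g xs)) (sym (+-suc _ _))
... | false | _     = count-split p g xs

count-map : ∀ {A B : Set} (p : B → Bool) (f : A → B) (xs : List A) → count p (List.map f xs) ≡ count (p ∘ f) xs
count-map p f [] = refl
count-map p f (x ∷ xs) with p (f x)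
... | true  = cong suc (count-map p f xs)
... | false = count-map p f xs

count-++ : ∀ {A : Set} (p : A → Bool) (xs ys : List A) → count p (xs ++ ys) ≡ count p xs + count p ys
count-++ p xs ys = trans (cong length (filter-++ (T? ∘ p) xs ys)) (length-++ (filterᵇ p xs))

count-none : ∀ {A : Set} (p : A → Bool) (xs : List A) → (∀ x → ¬ T (p x)) → count p xs ≡ 0
count-none p xs h = cong length (filter-none (T? ∘ p) {xs} (All.tabulate λ {x} _ → h x))

count-positive : ∀ {A : Set} (p : A → Bool) {xs : List A} {x : A} → x ∈ xs → T (p x) → 0 < count p xs
count-positive p {xs} x∈ px = filter-some (T? ∘ p) {xs} (Any.map (λ { refl → px }) x∈)

count-concatMap : ∀ {X Y : Set} (p : Y → Bool) (v : X → Bool) (g : X → List Y) (B : ℕ) (xs : List X) →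
                  (∀ x → T (v x) → count p (g x) ≤ B) → (∀ x → ¬ T (v x) → count p (g x) ≡ 0) →
                  count p (concatMap g xs) ≤ count v xs * B
count-concatMap p v g B [] hv hnv = z≤n
count-concatMap p v g B (x ∷ xs) hv hnv rewrite count-++ p (g x) (concatMap g xs) with v x | hv x | hnv x
... | true  | hx | _  = +-mono-≤ (hx _) (count-concatMap p v g B xs hv hnv)
... | false | _  | hx rewrite hx (λ ()) = count-concatMap p v g B xs hv hnv

remove : ∀ {B : Set} {b : B} {ys : List B} → b ∈ ys →
         Σ (List B) λ ys' → length ys ≡ suc (length ys') × (∀ {z} → z ∈ ys → z ≢ b → z ∈ ys')
remove {ys = y ∷ ys} (here refl) = ys , refl , λ { (here refl) z≢b → ⊥-elim (z≢b refl) ; (there z∈) _ → z∈ }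
remove {ys = y ∷ ys} (there b∈) with remove b∈
... | ys' , len , keep = y ∷ ys' , cong suc len , λ { (here refl) _ → here refl ; (there z∈) z≢b → there (keep z∈ z≢b) }

injection-length : ∀ {A B : Set} (R : A → B → Set) (xs : List A) (ys : List B) → Unique xs →
                   (∀ {a} → a ∈ xs → Σ B λ b → b ∈ ys × R a b) →
                   (∀ {a a' b} → a ∈ xs → a' ∈ xs → R a b → R a' b → a ≡ a') →
                   length xs ≤ length ys
injection-length R [] ys _ _ _ = z≤n
injection-length R (x ∷ xs) ys (x∉xs ∷ xs-unique) partner injective
  with partner (here refl)
... | b , b∈ys , xRb with remove b∈ys
...   | ys' , len , keep = subst (suc (length xs) ≤_) (sym len)
          (s≤s (injection-length R xs ys' xs-unique partner' (λ p q → injective (there p) (there q))))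
  where
  partner' : ∀ {a} → a ∈ xs → Σ _ λ b' → b' ∈ ys' × R a b'
  partner' a∈ with partner (there a∈)
  ... | b' , b'∈ys , aRb' =
    b' , keep b'∈ys (λ { refl → All.lookup x∉xs a∈ (injective (here refl) (there a∈) xRb aRb') }) , aRb'

size : ∀ {m} → (Fin m → Bool) → ℕ
size {m} f = count f (List.allFin m)

count-tabulate : ∀ {m k} (f : Fin k → Bool) (g : Fin m → Fin k) → ∣ tabulate (f ∘ g) ∣ ≡ count f (List.tabulate g)
count-tabulate {zero}  f g = refl
count-tabulate {suc m} f g with f (g zero)
... | true  = cong suc (count-tabulate f (g ∘ suc))
... | false = count-tabulate f (g ∘ suc)

size-tabulate : ∀ {m} (f : Fin m → Bool) → ∣ tabulate f ∣ ≡ size f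
size-tabulate f = count-tabulate f (λ x → x)

size-lookup : ∀ {m} (s : Subset m) → size (lookup s) ≡ ∣ s ∣
size-lookup s = trans (sym (size-tabulate (lookup s))) (cong ∣_∣ (tabulate∘lookup s))

subset-ext : ∀ {m} (u v : Subset m) → (∀ y → T (lookup u y) → T (lookup v y)) → (∀ y → T (lookup v y) → T (lookup u y)) → u ≡ v
subset-ext []      []      _ _ = refl
subset-ext (a ∷ u) (b ∷ v) uv vu = cong₂ _∷_ (bool-ext a b (uv zero) (vu zero)) (subset-ext u v (uv ∘ suc) (vu ∘ suc))
  where
  bool-ext : ∀ a b → (T a → T b) → (T b → T a) → a ≡ b
  bool-ext false false _ _ = refl
  bool-ext false true  _ g = ⊥-elim (g _)
  bool-ext true  false f _ = ⊥-elim (f _)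
  bool-ext true  true  _ _ = refl

extensions : ∀ {m} → Subset m → List (Subset (suc m))
extensions s = (true ∷ s) ∷ (false ∷ s) ∷ []

count-extensions : ∀ {m} (p : Subset (suc m) → Bool) (xs : List (Subset m)) →
                   count p (concatMap extensions xs) ≡ count (p ∘ (true ∷_)) xs + count (p ∘ (false ∷_)) xs
count-extensions p [] = refl
count-extensions p (x ∷ xs) with p (true ∷ x)
... | true  with p (false ∷ x)
...   | true  = cong suc (trans (cong suc (count-extensions p xs)) (sym (+-suc _ _)))
...   | false = cong suc (count-extensions p xs)
count-extensions p (x ∷ xs) | false with p (false ∷ x)
...   | true  = trans (cong suc (count-extensions p xs)) (sym (+-suc _ _))
...   | false = count-extensions p xs

allSubsets-complete : ∀ {m} (v : Subset m) → v ∈ allSubsets m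
allSubsets-complete []      = here refl
allSubsets-complete (b ∷ v) = extension-∈ b (allSubsets-complete v)
  where
  extension-∈ : ∀ {m} {s : Subset m} (b : Bool) {xs} → s ∈ xs → (b ∷ s) ∈ concatMap extensions xs
  extension-∈ true  (here refl) = here refl
  extension-∈ false (here refl) = there (here refl)
  extension-∈ b     (there s∈)  = there (there (extension-∈ b s∈))

allSubsets-unique : ∀ m → Unique (allSubsets m)
allSubsets-unique zero    = [] ∷ []
allSubsets-unique (suc m) = extensions-unique (allSubsets-unique m)
  where
  tail-∈ : ∀ {z : Subset (suc m)} xs → z ∈ concatMap extensions xs → tail z ∈ xs
  tail-∈ (x ∷ xs) (here refl)         = here refl
  tail-∈ (x ∷ xs) (there (here refl)) = here refl
  tail-∈ (x ∷ xs) (there (there z∈))  = there (tail-∈ xs z∈)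

  fresh : ∀ {x xs} (b : Bool) → All (x ≢_) xs → All ((b ∷ x) ≢_) (concatMap extensions xs)
  fresh {xs = xs} b x∉ = All.tabulate λ z∈ eq → All.lookup x∉ (tail-∈ xs z∈) (cong tail eq)

  extensions-unique : ∀ {xs} → Unique xs → Unique (concatMap extensions xs)
  extensions-unique []             = []
  extensions-unique (x∉ ∷ xs-uniq) =
    ((λ ()) ∷ fresh true x∉) ∷ fresh false x∉ ∷ extensions-unique xs-uniq

-- Number of t-subsets of V: Pascal's rule, splitting on the first coordinate.
count-subsets : ∀ {m} (V : Subset m) (t : ℕ) → count (λ B → subsetᵇ B V ∧ (∣ B ∣ ≡ᵇ t)) (allSubsets m) ≡ ∣ V ∣ C t
count-subsets []             zero    = refl
count-subsets []             (suc t) = refl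
count-subsets {suc m} (true ∷ V) zero = begin
  count _ (allSubsets (suc m))
    ≡⟨ count-extensions _ (allSubsets m) ⟩
  count (λ B → subsetᵇ B V ∧ false) (allSubsets m) + count (λ B → subsetᵇ B V ∧ (∣ B ∣ ≡ᵇ 0)) (allSubsets m)
    ≡⟨ cong₂ _+_ (count-none _ (allSubsets m) (λ B p → proj₂ (∧-split (subsetᵇ B V) p))) (count-subsets V zero) ⟩
  ∣ V ∣ C 0 ∎
  where open ≡-Reasoning
count-subsets {suc m} (true ∷ V) (suc t) = begin
  count _ (allSubsets (suc m))
    ≡⟨ count-extensions _ (allSubsets m) ⟩
  count (λ B → subsetᵇ B V ∧ (∣ B ∣ ≡ᵇ t)) (allSubsets m) + count (λ B → subsetᵇ B V ∧ (∣ B ∣ ≡ᵇ suc t)) (allSubsets m)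
    ≡⟨ cong₂ _+_ (count-subsets V t) (count-subsets V (suc t)) ⟩
  ∣ V ∣ C t + ∣ V ∣ C suc t
    ≡⟨ nCk+nC[k+1]≡[n+1]C[k+1] ∣ V ∣ t ⟩
  suc ∣ V ∣ C suc t ∎
  where open ≡-Reasoning
count-subsets {suc m} (false ∷ V) t = begin
  count _ (allSubsets (suc m))
    ≡⟨ count-extensions _ (allSubsets m) ⟩
  count (λ _ → false) (allSubsets m) + count (λ B → subsetᵇ B V ∧ (∣ B ∣ ≡ᵇ t)) (allSubsets m)
    ≡⟨ cong₂ _+_ (count-none _ (allSubsets m) (λ _ ())) (count-subsets V t) ⟩
  ∣ V ∣ C t ∎
  where open ≡-Reasoning

C-factorials : ∀ n k → k ≤ n → (n C k) * (k ! * (n ∸ k) !) ≡ n !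
C-factorials n k k≤n =
  trans (cong (_* (k ! * (n ∸ k) !)) (nCk≡n!/k![n-k]! k≤n)) (m/n*n≡m {{k !* (n ∸ k) !≢0}} (k![n∸k]!∣n! k≤n))

-- Choosing a t-set and then an s-set from the remainder is choosing a (t + s)-set
-- and then splitting it; both sides times t! s! (a ∸ (t + s))! equal a!.
C-C : ∀ a t s → t + s ≤ a → (a C t) * ((a ∸ t) C s) ≡ (a C (t + s)) * ((t + s) C t)
C-C a t s t+s≤a = *-cancelʳ-≡ _ _ (t ! * (s ! * R)) {{nonZero}} (trans lhs (sym rhs))
  where
  R = (a ∸ (t + s)) !
  nonZero = m*n≢0 (t !) (s ! * R) {{t !≢0}} {{m*n≢0 (s !) R {{s !≢0}} {{(a ∸ (t + s)) !≢0}}}}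
  t≤a : t ≤ a
  t≤a = ≤-trans (m≤m+n t s) t+s≤a
  s≤a∸t : s ≤ a ∸ t
  s≤a∸t = m+n≤o⇒m≤o∸n s (subst (_≤ a) (+-comm t s) t+s≤a)
  shuffleˡ : ∀ x y z w → x * y * (z * w) ≡ x * (z * (y * w))
  shuffleˡ = solve-∀
  shuffleʳ : ∀ u v x y z → u * v * (x * (y * z)) ≡ u * (v * (x * y) * z)
  shuffleʳ = solve-∀
  open ≡-Reasoning
  lhs : (a C t) * ((a ∸ t) C s) * (t ! * (s ! * R)) ≡ a !
  lhs = begin
    (a C t) * ((a ∸ t) C s) * (t ! * (s ! * R))   ≡⟨ shuffleˡ (a C t) ((a ∸ t) C s) (t !) (s ! * R) ⟩
    (a C t) * (t ! * (((a ∸ t) C s) * (s ! * R))) ≡⟨ cong (λ z → (a C t) * (t ! * (((a ∸ t) C s) * (s ! * z !)))) (sym (∸-+-assoc a t s)) ⟩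
    (a C t) * (t ! * (((a ∸ t) C s) * (s ! * (a ∸ t ∸ s) !))) ≡⟨ cong (λ z → (a C t) * (t ! * z)) (C-factorials (a ∸ t) s s≤a∸t) ⟩
    (a C t) * (t ! * (a ∸ t) !)                   ≡⟨ C-factorials a t t≤a ⟩
    a ! ∎
  rhs : (a C (t + s)) * ((t + s) C t) * (t ! * (s ! * R)) ≡ a !
  rhs = begin
    (a C (t + s)) * ((t + s) C t) * (t ! * (s ! * R))   ≡⟨ shuffleʳ (a C (t + s)) ((t + s) C t) (t !) (s !) R ⟩
    (a C (t + s)) * (((t + s) C t) * (t ! * s !) * R)   ≡⟨ cong (λ z → (a C (t + s)) * (((t + s) C t) * (t ! * z !) * R)) (sym (m+n∸m≡n t s)) ⟩
    (a C (t + s)) * (((t + s) C t) * (t ! * (t + s ∸ t) !) * R) ≡⟨ cong (λ z → (a C (t + s)) * (z * R)) (C-factorials (t + s) t (m≤m+n t s)) ⟩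
    (a C (t + s)) * ((t + s) ! * R)                     ≡⟨ C-factorials a (t + s) t+s≤a ⟩
    a ! ∎

map-applyUpTo : ∀ (f g : ℕ → ℕ) n → List.map f (applyUpTo g n) ≡ applyUpTo (f ∘ g) n
map-applyUpTo f g zero    = refl
map-applyUpTo f g (suc n) = cong (f (g 0) ∷_) (map-applyUpTo f (g ∘ suc) n)

module _ (t : ℕ) where

  -- choices k a = ∏_{i<k} C(a ∸ i t, t): the number of ways to pick, in order,
  -- k disjoint t-subsets of an a-element set.
  choices : ℕ → ℕ → ℕ
  choices zero    a = 1
  choices (suc k) a = (a C t) * choices k (a ∸ t)

  -- blocks k = ∏_{j=1}^{k} C(j t, t): the ways to cut a k t-set into k ordered t-sets.
  blocks : ℕ → ℕ
  blocks zero    = 1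
  blocks (suc k) = ((suc k * t) C t) * blocks k

  -- Choosing k ordered blocks = choosing their union, then cutting it.
  choices-blocks : ∀ k a → k * t ≤ a → choices k a ≡ (a C (k * t)) * blocks k
  choices-blocks zero    a _   = refl
  choices-blocks (suc k) a kt≤a = begin
    (a C t) * choices k (a ∸ t)                 ≡⟨ cong ((a C t) *_) (choices-blocks k (a ∸ t) kt≤a∸t) ⟩
    (a C t) * (((a ∸ t) C (k * t)) * blocks k)  ≡⟨ sym (*-assoc (a C t) _ (blocks k)) ⟩
    (a C t) * ((a ∸ t) C (k * t)) * blocks k    ≡⟨ cong (_* blocks k) (C-C a t (k * t) kt≤a) ⟩
    (a C (t + k * t)) * ((t + k * t) C t) * blocks k ≡⟨ *-assoc (a C (t + k * t)) _ (blocks k) ⟩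
    (a C (t + k * t)) * blocks (suc k) ∎
    where
    open ≡-Reasoning
    kt≤a∸t : k * t ≤ a ∸ t
    kt≤a∸t = m+n≤o⇒m≤o∸n (k * t) (subst (_≤ a) (+-comm t (k * t)) kt≤a)

  -- The top j factors of blocks (d + j), written with applyUpTo as in the theorem.
  blocks-product : ∀ d j → blocks (d + j) ≡ product (applyUpTo (λ i → ((d + j ∸ i) * t) C t) j) * blocks d
  blocks-product d zero    rewrite +-identityʳ d = sym (+-identityʳ (blocks d))
  blocks-product d (suc j) rewrite +-suc d j =
    trans (cong (top *_) (blocks-product d j)) (sym (*-assoc top (product (applyUpTo lower j)) (blocks d)))
    where
    top = (suc (d + j) * t) C t
    lower = λ i → ((d + j ∸ i) * t) C t

  -- For n = j + 1 ≥ 1 this is the bound of the theorem (the last factor C(t, t) = 1 is omitted there).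
  choices-closed : ∀ j a → suc j * t ≤ a →
                   choices (suc j) a ≡ (a C (suc j * t)) * product (List.map (λ i → ((suc j ∸ i) * t) C t) (upTo j))
  choices-closed j a le = begin
    choices (suc j) a                     ≡⟨ choices-blocks (suc j) a le ⟩
    (a C (suc j * t)) * blocks (suc j)    ≡⟨ cong ((a C (suc j * t)) *_) (blocks-product 1 j) ⟩
    (a C (suc j * t)) * (product (applyUpTo f j) * blocks 1)
      ≡⟨ cong (λ z → (a C (suc j * t)) * (product (applyUpTo f j) * z)) blocks-1 ⟩
    (a C (suc j * t)) * (product (applyUpTo f j) * 1)
      ≡⟨ cong ((a C (suc j * t)) *_) (trans (*-identityʳ _) (cong product (sym (map-applyUpTo _ (λ i → i) j)))) ⟩
    (a C (suc j * t)) * product (List.map f (upTo j)) ∎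
    where
    open ≡-Reasoning
    f = λ i → ((suc j ∸ i) * t) C t
    blocks-1 : blocks 1 ≡ 1
    blocks-1 = trans (*-identityʳ _) (trans (cong (_C t) (*-identityˡ t)) (nCn≡1 t))

squeeze : ∀ {t c X Y} → t + X ≤ c + Y → Y ≤ X → c ≤ t → c ≡ t × X ≤ Y
squeeze {t} {c} {X} {Y} le Y≤X c≤t = c≡t , +-cancelˡ-≤ t X Y (subst (λ z → t + X ≤ z + Y) c≡t le)
  where
  c≡t : c ≡ t
  c≡t = ≤-antisym c≤t (+-cancelʳ-≤ X t c (≤-trans le (+-monoʳ-≤ c Y≤X)))

room : ∀ n t r → r < t → n * t + r ≤ suc n * t ∸ 1
room n t r r<t = suc[m]≤n⇒m≤pred[n] (begin
  suc (n * t + r) ≡⟨ sym (+-suc (n * t) r) ⟩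
  n * t + suc r   ≤⟨ +-monoʳ-≤ (n * t) r<t ⟩
  n * t + t       ≡⟨ +-comm (n * t) t ⟩
  suc n * t       ∎)
  where open ≤-Reasoning

record Matching {m : ℕ} (ad : Fin m → Fin m → Bool) (S Q : Fin m → Bool) : Set where
  field
    uniqueˡ : ∀ {x x' y} → T (S x) → T (S x') → T (Q y) → T (ad x y) → T (ad x' y) → x ≡ x'
    uniqueʳ : ∀ {x y y'} → T (S x) → T (Q y) → T (Q y') → T (ad x y) → T (ad x y') → y ≡ y'

matching-mono : ∀ {m} {ad : Fin m → Fin m → Bool} {S S' Q Q' : Fin m → Bool} →
                (∀ {x} → T (S' x) → T (S x)) → (∀ {y} → T (Q' y) → T (Q y)) → Matching ad S Q → Matching ad S' Q'
matching-mono S'⊆S Q'⊆Q μ = record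
  { uniqueˡ = λ sx sx' qy → uniqueˡ (S'⊆S sx) (S'⊆S sx') (Q'⊆Q qy)
  ; uniqueʳ = λ sx qy qy' → uniqueʳ (S'⊆S sx) (Q'⊆Q qy) (Q'⊆Q qy') }
  where open Matching μ

module Peeling {m : ℕ} (ad : Fin m → Fin m → Bool) (t : ℕ) where

  adjacentTo : Subset m → Fin m → Bool
  adjacentTo s x = anyFin λ y → lookup s y ∧ ad x y

  seenBy : (Fin m → Bool) → Fin m → Bool
  seenBy S y = anyFin λ x → S x ∧ ad x y

  hit : (Fin m → Bool) → Subset m → Fin m → Bool
  hit S s x = S x ∧ adjacentTo s x

  _∖N_ : (Fin m → Bool) → Subset m → Fin m → Bool
  (S ∖N s) x = S x ∧ not (adjacentTo s x)

  survivors : ∀ {k} → (Fin m → Bool) → (Fin k → Subset m) → Fin m → Bool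
  survivors S A x = S x ∧ not (anyFin λ i → adjacentTo (A i) x)

  tSubsetOf : Subset m → Subset m → Bool
  tSubsetOf D0 s = subsetᵇ s D0 ∧ (∣ s ∣ ≡ᵇ t)

  inProduct : ∀ {k} → (Fin k → Subset m) → (Fin k → Subset m) → Bool
  inProduct D A = allFin λ i → tSubsetOf (D i) (A i)

  Matchings : ∀ {k} → (Fin m → Bool) → (Fin k → Subset m) → Set
  Matchings S D = ∀ i → Matching ad S (lookup (D i))

  matchings-tail : ∀ {k} S (D : Fin (suc k) → Subset m) s → Matchings S D → Matchings (S ∖N s) (D ∘ suc)
  matchings-tail S D s μ i = matching-mono (λ {x} → proj₁ ∘ ∧-split (S x)) (λ q → q) (μ (suc i))

  tSubset-matching : ∀ {S} D0 s → T (tSubsetOf D0 s) → Matching ad S (lookup D0) → Matching ad S (lookup s)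
  tSubset-matching D0 s s∈ = matching-mono (λ p → p) (λ {y} → subsetᵇ-elim s D0 (proj₁ (∧-split (subsetᵇ s D0) s∈)) y)

  tSubset-size : ∀ D0 s → T (tSubsetOf D0 s) → ∣ s ∣ ≡ t
  tSubset-size D0 s s∈ = ≡ᵇ⇒≡ ∣ s ∣ t (proj₂ (∧-split (subsetᵇ s D0) s∈))

  size-split : ∀ S s → size S ≡ size (hit S s) + size (S ∖N s)
  size-split S s = count-split S (adjacentTo s) (List.allFin m)

  -- Through a matching, distinct deleted vertices have distinct neighbours in s.
  hit≤seen : ∀ S s → Matching ad S (lookup s) → size (hit S s) ≤ size (λ y → lookup s y ∧ seenBy S y)
  hit≤seen S s μ = injection-length R hits seen (filter⁺ (T? ∘ hit S s) (allFin⁺ m)) partner injective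
    where
    hits = filterᵇ (hit S s) (List.allFin m)
    seen = filterᵇ (λ y → lookup s y ∧ seenBy S y) (List.allFin m)
    R : Fin m → Fin m → Set
    R x y = T (lookup s y) × T (ad x y)
    in-S : ∀ {x} → x ∈ hits → T (S x) × T (adjacentTo s x)
    in-S {x} x∈ = ∧-split (S x) (proj₂ (∈-filter⁻ (T? ∘ hit S s) {xs = List.allFin m} x∈))
    partner : ∀ {x} → x ∈ hits → Σ (Fin m) λ y → y ∈ seen × R x y
    partner {x} x∈ with anyFin-witness _ (proj₂ (in-S x∈))
    ... | y , sy∧axy with ∧-split (lookup s y) sy∧axy
    ...   | sy , axy =
      y , ∈-filter⁺ (T? ∘ _) (∈-allFin y) (∧-pair sy (anyFin-intro _ x (∧-pair (proj₁ (in-S x∈)) axy))) , sy , axy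
    injective : ∀ {x x' y} → x ∈ hits → x' ∈ hits → R x y → R x' y → x ≡ x'
    injective x∈ x'∈ (sy , axy) (_ , ax'y) = Matching.uniqueˡ μ (proj₁ (in-S x∈)) (proj₁ (in-S x'∈)) sy axy ax'y

  size-seen-unseen : ∀ S s → ∣ s ∣ ≡ size (λ y → lookup s y ∧ seenBy S y) + size (λ y → lookup s y ∧ not (seenBy S y))
  size-seen-unseen S s = trans (sym (size-lookup s)) (count-split (lookup s) (seenBy S) (List.allFin m))

  hit≤t : ∀ S D0 s → Matching ad S (lookup D0) → T (tSubsetOf D0 s) → size (hit S s) ≤ t
  hit≤t S D0 s μ s∈ = begin
    size (hit S s)                                  ≤⟨ hit≤seen S s (tSubset-matching D0 s s∈ μ) ⟩
    size (λ y → lookup s y ∧ seenBy S y)            ≤⟨ m≤m+n _ _ ⟩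
    size (λ y → lookup s y ∧ seenBy S y) + size (λ y → lookup s y ∧ not (seenBy S y)) ≡⟨ sym (size-seen-unseen S s) ⟩
    ∣ s ∣                                           ≡⟨ tSubset-size D0 s s∈ ⟩
    t                                               ∎
    where open ≤-Reasoning

  survivors-step : ∀ {k} S (A : Fin (suc k) → Subset m) x → survivors S A x ≡ survivors (S ∖N A zero) (A ∘ suc) x
  survivors-step S A x with S x | adjacentTo (A zero) x
  ... | true  | true  = refl
  ... | true  | false = refl
  ... | false | _     = refl

  size-survivors-step : ∀ {k} S (A : Fin (suc k) → Subset m) → size (survivors S A) ≡ size (survivors (S ∖N A zero) (A ∘ suc))
  size-survivors-step S A = count-cong (List.allFin m) (survivors-step S A)

  size-survivors : ∀ k (D A : Fin k → Subset m) S → Matchings S D → T (inProduct D A) → size S ≤ size (survivors S A) + k * t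
  size-survivors zero    D A S μ _  =
    ≤-reflexive (trans (count-cong (List.allFin m) (λ x → sym (∧-identityʳ (S x)))) (sym (+-identityʳ _)))
  size-survivors (suc k) D A S μ A∈ = begin
    size S                                         ≡⟨ size-split S s ⟩
    size (hit S s) + size (S ∖N s)                 ≤⟨ +-mono-≤ (hit≤t S (D zero) s (μ zero) s∈) rest ⟩
    t + (size (survivors (S ∖N s) (A ∘ suc)) + k * t) ≡⟨ m+[n+o]≡n+[m+o] t _ (k * t) ⟩
    size (survivors (S ∖N s) (A ∘ suc)) + (t + k * t) ≡⟨ cong (_+ (t + k * t)) (sym (size-survivors-step S A)) ⟩
    size (survivors S A) + (t + k * t)             ∎
    where
    open ≤-Reasoning
    s = A zero
    s∈ = proj₁ (∧-split (tSubsetOf (D zero) s) A∈)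
    rest = size-survivors k (D ∘ suc) (A ∘ suc) (S ∖N s) (matchings-tail S D s μ) (proj₂ (∧-split (tSubsetOf (D zero) s) A∈))

  -- A tuple is tight for S if it lies in ∏ D i and its k sets delete at least
  -- (by size-survivors: exactly) k t vertices of S.
  tight : ∀ {k} → (Fin m → Bool) → (Fin k → Subset m) → (Fin k → Subset m) → Bool
  tight {k} S D A = inProduct D A ∧ (k * t + size (survivors S A) ≤ᵇ size S)

  -- A possible first set of a tight tuple: a t-subset of D0 deleting exactly t vertices of S.
  admissible : (Fin m → Bool) → Subset m → Subset m → Bool
  admissible S D0 s = tSubsetOf D0 s ∧ (size (hit S s) ≡ᵇ t)

  admissible-size : ∀ S D0 s → T (admissible S D0 s) → size (S ∖N s) ≡ size S ∸ t
  admissible-size S D0 s adm = sym (begin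
    size S ∸ t                          ≡⟨ cong (_∸ t) (size-split S s) ⟩
    size (hit S s) + size (S ∖N s) ∸ t  ≡⟨ cong (λ h → h + size (S ∖N s) ∸ t) hit≡t ⟩
    t + size (S ∖N s) ∸ t               ≡⟨ m+n∸m≡n t (size (S ∖N s)) ⟩
    size (S ∖N s)                       ∎)
    where
    open ≡-Reasoning
    hit≡t = ≡ᵇ⇒≡ (size (hit S s)) t (proj₂ (∧-split (tSubsetOf D0 s) adm))

  -- A tight tuple starts with an admissible set, and its remaining sets are tight
  -- for the survivors of the first one: no deletion budget can be lost on the way.
  tight-peel : ∀ {k} S (D A : Fin (suc k) → Subset m) → Matchings S D → T (tight S D A) →
               T (admissible S (D zero) (A zero)) × T (tight (S ∖N A zero) (D ∘ suc) (A ∘ suc))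
  tight-peel {k} S D A μ tA =
    ∧-pair s∈ (≡⇒≡ᵇ (size (hit S s)) t (proj₁ balance)) , ∧-pair rest∈ (≤⇒≤ᵇ (proj₂ balance))
    where
    s = A zero
    S' = S ∖N s
    r = size (survivors S' (A ∘ suc))
    A∈ = proj₁ (∧-split (inProduct D A) tA)
    s∈ = proj₁ (∧-split (tSubsetOf (D zero) s) A∈)
    rest∈ = proj₂ (∧-split (tSubsetOf (D zero) s) A∈)
    deletes : t + (k * t + r) ≤ size (hit S s) + size S'
    deletes = subst₂ _≤_ (trans (cong (suc k * t +_) (size-survivors-step S A)) (+-assoc t (k * t) r)) (size-split S s)
                         (≤ᵇ⇒≤ _ _ (proj₂ (∧-split (inProduct D A) tA)))
    rest-bound : size S' ≤ k * t + r
    rest-bound = subst (size S' ≤_) (+-comm r (k * t)) (size-survivors k (D ∘ suc) (A ∘ suc) S' (matchings-tail S D s μ) rest∈)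
    balance : size (hit S s) ≡ t × k * t + r ≤ size S'
    balance = squeeze deletes rest-bound (hit≤t S (D zero) s (μ zero) s∈)

  -- Every vertex of an admissible s has a neighbour in S: s deletes t = |s| vertices
  -- of S, and these have distinct neighbours in s.
  admissible-saturated : ∀ S D0 s → Matching ad S (lookup D0) → T (admissible S D0 s) →
                         ∀ y → T (lookup s y) → T (seenBy S y)
  admissible-saturated S D0 s μ adm y sy with seenBy S y in seen?
  ... | true  = _
  ... | false = <⇒≢ (count-positive unseen (∈-allFin y) (∧-pair sy (subst (T ∘ not) (sym seen?) _))) (sym none-unseen)
    where
    unseen : Fin m → Bool
    unseen y = lookup s y ∧ not (seenBy S y)
    seen = size (λ y → lookup s y ∧ seenBy S y)
    s∈ = proj₁ (∧-split (tSubsetOf D0 s) adm)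
    seen-all : seen + size unseen ≤ seen + 0
    seen-all = begin
      seen + size unseen  ≡⟨ sym (size-seen-unseen S s) ⟩
      ∣ s ∣               ≡⟨ tSubset-size D0 s s∈ ⟩
      t                   ≡⟨ sym (≡ᵇ⇒≡ (size (hit S s)) t (proj₂ (∧-split (tSubsetOf D0 s) adm))) ⟩
      size (hit S s)      ≤⟨ hit≤seen S s (tSubset-matching D0 s s∈ μ) ⟩
      seen                ≡⟨ sym (+-identityʳ seen) ⟩
      seen + 0            ∎
      where open ≤-Reasoning
    none-unseen : size unseen ≡ 0
    none-unseen = n≤0⇒n≡0 (+-cancelˡ-≤ seen (size unseen) 0 seen-all)

  shadow : (Fin m → Bool) → Subset m → Subset m
  shadow S s = tabulate (hit S s)

  shadow-within : ∀ S s → T (subsetᵇ (shadow S s) (tabulate S))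
  shadow-within S s = allFin-intro _ λ x →
    subst₂ (λ a b → T (not a ∨ b)) (sym (lookup∘tabulate (hit S s) x)) (sym (lookup∘tabulate S x)) (∧-implies (S x) _)
    where
    ∧-implies : ∀ a b → T (not (a ∧ b) ∨ a)
    ∧-implies true  true  = _
    ∧-implies true  false = _
    ∧-implies false _     = _

  shadow-size : ∀ S D0 s → T (admissible S D0 s) → ∣ shadow S s ∣ ≡ t
  shadow-size S D0 s adm = trans (size-tabulate (hit S s)) (≡ᵇ⇒≡ _ t (proj₂ (∧-split (tSubsetOf D0 s) adm)))

  -- Admissible sets are determined by their shadow: each y ∈ s has an S-neighbour x,
  -- which lies in the shadow, and y is the only neighbour of x in D0.
  shadow-injective : ∀ S D0 → Matching ad S (lookup D0) → ∀ u u' → T (admissible S D0 u) → T (admissible S D0 u') →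
                     shadow S u ≡ shadow S u' → u ≡ u'
  shadow-injective S D0 μ u u' adm adm' eq = subset-ext u u' (shadow-⊆ u u' adm adm' eq) (shadow-⊆ u' u adm' adm (sym eq))
    where
    within : ∀ u → T (admissible S D0 u) → ∀ y → T (lookup u y) → T (lookup D0 y)
    within u adm = subsetᵇ-elim u D0 (proj₁ (∧-split (subsetᵇ u D0) (proj₁ (∧-split (tSubsetOf D0 u) adm))))
    shadow-⊆ : ∀ u u' → T (admissible S D0 u) → T (admissible S D0 u') → shadow S u ≡ shadow S u' →
               ∀ y → T (lookup u y) → T (lookup u' y)
    shadow-⊆ u u' adm adm' eq y uy
      with anyFin-witness _ (admissible-saturated S D0 u μ adm y uy)
    ... | x , sx∧axy with ∧-split (S x) sx∧axy
    ...   | sx , axy with anyFin-witness _ (proj₂ (∧-split (S x) hit'))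
      where
      x-hit : T (hit S u x)
      x-hit = ∧-pair sx (anyFin-intro _ y (∧-pair uy axy))
      hit' : T (hit S u' x)
      hit' = subst T (trans (sym (lookup∘tabulate (hit S u) x))
                     (trans (cong (λ v → lookup v x) eq) (lookup∘tabulate (hit S u') x))) x-hit
    ...     | y' , u'y'∧axy' with ∧-split (lookup u' y') u'y'∧axy'
    ...       | u'y' , axy' =
      subst (T ∘ lookup u') (sym (Matching.uniqueʳ μ sx (within u adm y uy) (within u' adm' y' u'y') axy axy')) u'y'

  -- At most C(|S|, t) admissible sets: shadows are distinct t-subsets of S.
  count-admissible : ∀ S D0 → Matching ad S (lookup D0) → count (admissible S D0) (allSubsets m) ≤ size S C t
  count-admissible S D0 μ = begin
    count (admissible S D0) (allSubsets m)
      ≤⟨ injection-length (λ s B → B ≡ shadow S s) (filterᵇ (admissible S D0) (allSubsets m))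
            (filterᵇ tSubsetOfS (allSubsets m)) (filter⁺ (T? ∘ admissible S D0) (allSubsets-unique m)) partner injective ⟩
    count tSubsetOfS (allSubsets m)   ≡⟨ count-subsets (tabulate S) t ⟩
    ∣ tabulate S ∣ C t                ≡⟨ cong (_C t) (size-tabulate S) ⟩
    size S C t                        ∎
    where
    open ≤-Reasoning
    tSubsetOfS : Subset m → Bool
    tSubsetOfS = tSubsetOf (tabulate S)
    admissible-∈ : ∀ {s} → s ∈ filterᵇ (admissible S D0) (allSubsets m) → T (admissible S D0 s)
    admissible-∈ s∈ = proj₂ (∈-filter⁻ (T? ∘ admissible S D0) {xs = allSubsets m} s∈)
    partner : ∀ {s} → s ∈ filterᵇ (admissible S D0) (allSubsets m) →
              Σ (Subset m) λ B → B ∈ filterᵇ tSubsetOfS (allSubsets m) × B ≡ shadow S s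
    partner {s} s∈ = shadow S s , ∈-filter⁺ (T? ∘ tSubsetOfS) (allSubsets-complete (shadow S s))
      (∧-pair (shadow-within S s) (≡⇒≡ᵇ _ t (shadow-size S D0 s (admissible-∈ s∈)))) , refl
    injective : ∀ {s s' B} → s ∈ filterᵇ (admissible S D0) (allSubsets m) → s' ∈ filterᵇ (admissible S D0) (allSubsets m) →
                B ≡ shadow S s → B ≡ shadow S s' → s ≡ s'
    injective {s} {s'} s∈ s'∈ refl eq = shadow-injective S D0 μ s s' (admissible-∈ s∈) (admissible-∈ s'∈) eq

  -- Tight tuples number at most choices t k |S|: peel off the admissible first set.
  count-tight : ∀ k (D : Fin k → Subset m) S → Matchings S D → count (tight S D) (allTuples k m) ≤ choices t k (size S)
  count-tight zero    D S μ = length-filter (T? ∘ tight S D) (allTuples zero m)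
  count-tight (suc k) D S μ = begin
    count (tight S D) (allTuples (suc k) m)
      ≤⟨ count-concatMap (tight S D) (admissible S (D zero)) (λ s → List.map (consF s) (allTuples k m))
                          (choices t k (size S ∸ t)) (allSubsets m) extend dead ⟩
    count (admissible S (D zero)) (allSubsets m) * choices t k (size S ∸ t)
      ≤⟨ *-monoˡ-≤ (choices t k (size S ∸ t)) (count-admissible S (D zero) (μ zero)) ⟩
    (size S C t) * choices t k (size S ∸ t) ∎
    where
    open ≤-Reasoning
    extend : ∀ s → T (admissible S (D zero) s) → count (tight S D) (List.map (consF s) (allTuples k m)) ≤ choices t k (size S ∸ t)
    extend s adm = begin
      count (tight S D) (List.map (consF s) (allTuples k m)) ≡⟨ count-map (tight S D) (consF s) (allTuples k m) ⟩
      count (tight S D ∘ consF s) (allTuples k m)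
        ≤⟨ count-mono (allTuples k m) (λ A tA → proj₂ (tight-peel S D (consF s A) μ tA)) ⟩
      count (tight (S ∖N s) (D ∘ suc)) (allTuples k m)
        ≤⟨ count-tight k (D ∘ suc) (S ∖N s) (matchings-tail S D s μ) ⟩
      choices t k (size (S ∖N s))                       ≡⟨ cong (choices t k) (admissible-size S (D zero) s adm) ⟩
      choices t k (size S ∸ t)                          ∎
    dead : ∀ s → ¬ T (admissible S (D zero) s) → count (tight S D) (List.map (consF s) (allTuples k m)) ≡ 0
    dead s ¬adm = trans (count-map (tight S D) (consF s) (allTuples k m))
                        (count-none _ (allTuples k m) λ A tA → ¬adm (proj₁ (tight-peel S D (consF s A) μ tA)))

isLast-inject₁ : ∀ {n} (i : Fin n) → isLast (inject₁ i) ≡ false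
isLast-inject₁ {suc n} zero    = refl
isLast-inject₁ {suc n} (suc i) = isLast-inject₁ i

isLast-fromℕ : ∀ n → isLast (fromℕ n) ≡ true
isLast-fromℕ zero    = refl
isLast-fromℕ (suc n) = isLast-fromℕ n

spoke : ∀ {n} (i : Fin n) → adj (Kn1 n) (vtx i) u₁ ≡ true
spoke {n} i rewrite isLast-inject₁ i | isLast-fromℕ n = refl

cover-matchings : ∀ {n m} (H : Graph m) (L : Fin (suc n) → Subset m) → IsCover (Kn1 n) H L →
                  ∀ i → Matching (adj H) (lookup (L u₁)) (lookup (L (vtx i)))
cover-matchings {n} H L cover i = record
  { uniqueˡ = λ sx sx' qy axy ax'y →
      matching (vtx i) u₁ (spoke i) _ _ _ (member qy) (member sx) (member sx') (edge (flip axy)) (edge (flip ax'y))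
  ; uniqueʳ = λ sx qy qy' axy axy' →
      matching u₁ (vtx i) (trans (symm (Kn1 n) u₁ (vtx i)) (spoke i)) _ _ _ (member sx) (member qy) (member qy') (edge axy) (edge axy') }
  where
  open IsCover cover using (matching)
  member : ∀ {p : Subset _} {x} → T (lookup p x) → Data.Fin.Subset._∈_ x p
  member {p} {x} px = lookup⇒[]= x p (to T-≡ px)
  edge : ∀ {x y} → T (adj H x y) → adj H x y ≡ true
  edge = to T-≡
  flip : ∀ {x y} → T (adj H x y) → T (adj H y x)
  flip {x} {y} = subst T (symm H x y)

lemma14 : (n t m : ℕ) → 2 ≤ n → 1 ≤ t →
          (H : Graph m) (L : Fin (suc n) → Subset m) →
          IsCover (Kn1 n) H L → IsFold (suc n * t ∸ 1) L →
          numBad n m t H L ≤ ((suc n * t ∸ 1) C (n * t)) * product (map (λ i → ((n ∸ i) * t) C t) (upTo (n ∸ 1)))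
lemma14 (suc j) t m _ t≥1 H L cover fold = begin
  numBad n m t H L                   ≤⟨ count-mono (allTuples n m) bad⇒tight ⟩
  count (tight S D) (allTuples n m)  ≤⟨ count-tight n D S (cover-matchings H L cover) ⟩
  choices t n (size S)               ≡⟨ cong (choices t n) size-S ⟩
  choices t n N                      ≡⟨ choices-closed t j N (subst (_≤ N) (+-identityʳ (n * t)) (room n t 0 t≥1)) ⟩
  (N C (n * t)) * product (map (λ i → ((n ∸ i) * t) C t) (upTo j)) ∎
  where
  open ≤-Reasoning
  open Peeling (adj H) t
  n = suc j
  N = suc n * t ∸ 1
  S = lookup (L u₁)
  D = L ∘ vtx
  size-S : size S ≡ N
  size-S = trans (size-lookup (L u₁)) (fold u₁)
  bad⇒tight : ∀ A → T (inProductᵇ t L A ∧ badᵇ t H L A) → T (tight S D A)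
  bad⇒tight A p = ∧-pair A∈ (≤⇒≤ᵇ (subst (n * t + r ≤_) (sym size-S) (room n t r r<t)))
    where
    A∈ = proj₁ (∧-split (inProductᵇ t L A) p)
    r = size (survivors S A)
    r<t : r < t
    r<t = subst (_< t) (size-tabulate (survivors S A)) (<ᵇ⇒< _ t (proj₂ (∧-split (inProductᵇ t L A) p)))
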